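{- Let $N\ge0$, let $\mathcal S\subseteq\Omega_N\cup\{V\}$ with $U_N\in\mathcal S$, and $\mathcal V=\mathcal S\cup\{V\}$, $\mathcal N=\mathcal S\setminus\{V\}$. For $n\ge1$, $$|\mathcal P_{\mathcal V}(1,n)|=\frac1n[y^{Nn+1}]\frac{1}{(1-y)^n}\Big(\sum_{S_k\in\mathcal N}y^{N-k}\Big)^n.$$
   Context: Steps: $V=(0,-1)$ and $S_k=(1,k)$ for $k\in\mathbb Z$; $U_k=S_k$ for $k\ge0$. $\Omega_N=\{S_k:k\le N\}$. For a set of steps $\mathcal S$, an $\mathcal S$-path is a finite sequence of steps from $\mathcal S$ starting at $(0,0)$. $\mathcal P_{\mathcal S}(m,n)$ is the set of $\mathcal S$-paths ending at $(n,-m)$ all of whose points except possibly the last lie on or above the $x$-axis. $[y^j]A(y)$ is the coefficient of $y^j$. -}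

module Defs where

open import Data.Nat as ℕ using (ℕ; zero; suc)
open import Data.Integer as ℤ using (ℤ; +_; -[1+_])
open import Data.Bool using (Bool; true; false; if_then_else_)
open import Data.Product using (Σ; _×_; _,_; proj₁; proj₂)
open import Data.Unit using (⊤)
open import Data.List using (List; []; _∷_)
open import Data.List.Relation.Unary.All using (All)
open import Relation.Binary.PropositionalEquality using (_≡_)

data Step : Set where
  V : Step
  S : ℤ → Step

Point : Set
Point = ℤ × ℤ

move : Point → Step → Point
move (x , y) V     = x , y ℤ.- ℤ.1ℤ
move (x , y) (S k) = x ℤ.+ ℤ.1ℤ , y ℤ.+ k

walkEnd : Point → List Step → Point
walkEnd p []       = p
walkEnd p (s ∷ ss) = walkEnd (move p s) ss

AboveExceptLast : Point → List Step → Set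
AboveExceptLast p []       = ⊤
AboveExceptLast p (s ∷ ss) = (ℤ.0ℤ ℤ.≤ proj₂ p) × AboveExceptLast (move p s) ss

-- A step set containing V, whose non-vertical part 𝒩 is given by a
-- Boolean predicate on ℤ: S k ∈ set  iff  inN k ≡ true.
InWithV : (ℤ → Bool) → Step → Set
InWithV inN V     = ⊤
InWithV inN (S k) = inN k ≡ true

Paths : (ℤ → Bool) → ℕ → ℕ → Set
Paths inN m n =
  Σ (List Step) λ ss →
    All (InWithV inN) ss ×
    (walkEnd (ℤ.0ℤ , ℤ.0ℤ) ss ≡ (+ n , ℤ.- (+ m))) ×
    AboveExceptLast (ℤ.0ℤ , ℤ.0ℤ) ss

Series : Set
Series = ℕ → ℕ

convAux : Series → Series → ℕ → ℕ → ℕ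
convAux f g j zero    = f 0 ℕ.* g j
convAux f g j (suc i) = f (suc i) ℕ.* g (j ℕ.∸ suc i) ℕ.+ convAux f g j i

_⊛_ : Series → Series → Series
(f ⊛ g) j = convAux f g j j

one : Series
one zero    = 1
one (suc _) = 0

_^ˢ_ : Series → ℕ → Series
f ^ˢ zero  = one
f ^ˢ suc n = f ⊛ (f ^ˢ n)

geom : Series
geom _ = 1

-- Σ_{S_k ∈ 𝒩} y^{N-k}  (for k ≤ N): coefficient of y^d is [S_{N-d} ∈ 𝒩]
stepSeries : ℕ → (ℤ → Bool) → Series
stepSeries N inN d = if inN (+ N ℤ.- + d) then 1 else 0

-- Cutting a path before each step S_k writes it as a word of n letters S_k V^j of height
-- k - j; it is a path of 𝒫_𝒱(1,n) exactly when the word has total height -1 and every proper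
-- prefix has height ≥ 0. By the cycle lemma exactly one of the n rotations of a word of total
-- height -1 has this property, so n |𝒫_𝒱(1,n)| is the number of words of total height -1.
-- Weighting a letter by j + (N - k) = N - (k - j), these are the words of total weight Nn + 1,
-- which (1/(1-y))^n (Σ y^(N-k))^n counts.

module Submission where

open import Defs
open import Axiom.UniquenessOfIdentityProofs.WithK using (uip)
open import Data.Bool using (Bool; true; false)
open import Data.Bool.Properties using (T-irrelevant)
open import Data.Empty using (⊥; ⊥-elim)
open import Data.Fin as Fin using (Fin; zero; suc; toℕ; fromℕ<)
import Data.Fin.Properties as Finₚ
open import Data.Fin.Permutation using (↔⇒≡)
open import Data.Integer as ℤ using (ℤ; +_; 0ℤ; 1ℤ; _-_; _≤_)
import Data.Integer.Properties as ℤₚ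
open import Data.Integer.Tactic.RingSolver using (solve-∀)
open import Data.List as List using (List; []; _∷_; _++_; length)
import Data.List.Properties as Listₚ
open import Data.List.Relation.Unary.All as All using (All; []; _∷_)
import Data.List.Relation.Unary.All.Properties as Allₚ
open import Data.Nat as ℕ using (ℕ; zero; suc; z≤n; s≤s; _+_; _*_; _∸_; _%_; _≥_)
import Data.Nat.Properties as ℕₚ
open import Data.Nat.DivMod
open import Data.Product using (Σ; _×_; _,_; proj₁; proj₂; uncurry)
open import Data.Product.Function.NonDependent.Propositional using (_×-↔_)
open import Data.Sum using (_⊎_; inj₁; inj₂; [_,_])
open import Data.Sum.Function.Propositional using (_⊎-↔_)
open import Data.Unit using (⊤; tt)
open import Data.Vec as Vec using (Vec; []; _∷_)
import Data.Vec.Properties as Vecₚ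
open import Function using (_∘_)
open import Function.Bundles using (_↔_; Inverse; mk↔ₛ′)
open import Function.Properties.Inverse using (↔-trans; ↔-sym; ↔-refl)
open import Function.Related.TypeIsomorphisms using (×-comm)
open import Relation.Nullary as Nullary using (Dec; yes; no)
open import Relation.Nullary.Decidable using (True; toWitness; fromWitness; _×-dec_)
open import Relation.Unary using (Decidable; Irrelevant)
open import Relation.Binary.PropositionalEquality hiding ([_])

-- Counting finite types

Σ-≡-irrelevant : {A : Set} {P : A → Set} → Irrelevant P →
                 {x y : A} {px : P x} {py : P y} → x ≡ y → (x , px) ≡ (y , py)
Σ-≡-irrelevant irr {px = px} {py} refl = cong (_ ,_) (irr px py)

Σ-↔-irrelevant : {A B : Set} {P : A → Set} {Q : B → Set} → Irrelevant P → Irrelevant Q →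
  (f : ∀ x → P x → B) (g : ∀ y → Q y → A)
  (f-resp : ∀ x p → Q (f x p)) (g-resp : ∀ y q → P (g y q)) →
  (∀ x p → g (f x p) (f-resp x p) ≡ x) → (∀ y q → f (g y q) (g-resp y q) ≡ y) →
  Σ A P ↔ Σ B Q
Σ-↔-irrelevant irrP irrQ f g f-resp g-resp g∘f f∘g =
  mk↔ₛ′ (λ (x , p) → f x p , f-resp x p) (λ (y , q) → g y q , g-resp y q)
        (λ (y , q) → Σ-≡-irrelevant irrQ (f∘g y q)) (λ (x , p) → Σ-≡-irrelevant irrP (g∘f x p))

Σ-Fin-suc-↔ : ∀ {C} {P : Fin (suc C) → Set} → Σ (Fin (suc C)) P ↔ (P zero ⊎ Σ (Fin C) (P ∘ suc))
Σ-Fin-suc-↔ = mk↔ₛ′ (λ { (zero , p) → inj₁ p ; (suc i , p) → inj₂ (i , p) })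
                     [ (zero ,_) , (λ (i , p) → suc i , p) ]
                     (λ { (inj₁ _) → refl ; (inj₂ _) → refl })
                     (λ { (zero , _) → refl ; (suc _ , _) → refl })

True-↔-Fin : {A : Set} (a? : Dec A) → Σ ℕ λ k → True a? ↔ Fin k
True-↔-Fin (yes _) = 1 , ↔-sym Finₚ.1↔⊤
True-↔-Fin (no _)  = 0 , ↔-sym Finₚ.0↔⊥

Fin-filter-↔ : ∀ {C} {P : Fin C → Set} (P? : Decidable P) →
               Σ ℕ λ c → Σ (Fin C) (λ i → True (P? i)) ↔ Fin c
Fin-filter-↔ {zero}  P? = 0 , mk↔ₛ′ (λ ()) (λ ()) (λ ()) (λ ())
Fin-filter-↔ {suc C} P? =
  let (k , head↔k) = True-↔-Fin (P? zero)
      (c , tail↔c) = Fin-filter-↔ (P? ∘ suc)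
  in k ℕ.+ c , ↔-trans Σ-Fin-suc-↔ (↔-trans (head↔k ⊎-↔ tail↔c) (↔-sym Finₚ.+↔⊎))

-- The copies G × {0} of G inside Fin C form a decidable subset of Fin C.
×-Fin-cancel : ∀ {G : Set} {n C} → (G × Fin (suc n)) ↔ Fin C →
               Σ ℕ λ c → (G ↔ Fin c) × suc n ℕ.* c ≡ C
×-Fin-cancel {G} {n} {C} G×n↔C = c , G↔c , sym (↔⇒≡ C↔n*c)
  where
  module I = Inverse G×n↔C

  atZero? : Decidable (λ i → proj₂ (I.from i) ≡ zero)
  atZero? i = proj₂ (I.from i) Fin.≟ zero

  c : ℕ
  c = proj₁ (Fin-filter-↔ atZero?)

  G↔atZero : G ↔ Σ (Fin C) (λ i → True (atZero? i))
  G↔atZero = mk↔ₛ′ (λ g → I.to (g , zero) , fromWitness (cong proj₂ (I.strictlyInverseʳ (g , zero))))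
                    (λ (i , _) → proj₁ (I.from i))
                    (λ (i , z) → Σ-≡-irrelevant T-irrelevant
                       (trans (cong (λ k → I.to (proj₁ (I.from i) , k)) (sym (toWitness {a? = atZero? i} z))) (I.strictlyInverseˡ i)))
                    (λ g → cong proj₁ (I.strictlyInverseʳ (g , zero)))

  G↔c : G ↔ Fin c
  G↔c = ↔-trans G↔atZero (proj₂ (Fin-filter-↔ atZero?))

  C↔n*c : Fin C ↔ Fin (suc n ℕ.* c)
  C↔n*c = ↔-trans (↔-sym G×n↔C) (↔-trans (×-comm G (Fin (suc n)))
            (↔-trans (↔-refl ×-↔ G↔c) (↔-sym Finₚ.*↔×)))

-- Generating series

CountedBy : {A : Set} → (A → ℕ) → Series → Set
CountedBy {A} w f = ∀ i → Σ A (λ a → w a ≡ i) ↔ Fin (f i)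

module _ {A B : Set} {wa : A → ℕ} {wb : B → ℕ} {f g : Series}
         (countA : CountedBy wa f) (countB : CountedBy wb g) where

  private
    Fibre : ℕ → ℕ → Set
    Fibre i j = Σ A (λ a → wa a ≡ i) × Σ B (λ b → wb b ≡ j)

    Fibre-↔ : ∀ i j → Fibre i j ↔ Fin (f i ℕ.* g j)
    Fibre-↔ i j = ↔-trans (countA i ×-↔ countB j) (↔-sym Finₚ.*↔×)

    Bounded : ℕ → ℕ → A × B → Set
    Bounded D t (a , b) = wa a ℕ.+ wb b ≡ D × wa a ℕ.≤ t

    Bounded-irrelevant : ∀ D t → Irrelevant (Bounded D t)
    Bounded-irrelevant D t (e , l) (e′ , l′) = cong₂ _,_ (uip e e′) (ℕₚ.≤-irrelevant l l′)

    Bounded-zero-↔ : ∀ D → Σ (A × B) (Bounded D 0) ↔ Fibre 0 D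
    Bounded-zero-↔ D = mk↔ₛ′ to from
      (λ ((a , p) , (b , q)) → cong₂ (λ u v → (a , u) , (b , v)) (uip _ p) (uip _ q))
      (λ _ → Σ-≡-irrelevant (Bounded-irrelevant D 0) refl)
      where
      to : Σ (A × B) (Bounded D 0) → Fibre 0 D
      to ((a , b) , (e , a≤0)) = (a , ℕₚ.n≤0⇒n≡0 a≤0) , (b , trans (cong (ℕ._+ wb b) (sym (ℕₚ.n≤0⇒n≡0 a≤0))) e)
      from : Fibre 0 D → Σ (A × B) (Bounded D 0)
      from ((a , p) , (b , q)) = (a , b) , (cong₂ ℕ._+_ p q , ℕₚ.≤-reflexive p)

    Bounded-suc-↔ : ∀ D t → suc t ℕ.≤ D →
      Σ (A × B) (Bounded D (suc t)) ↔ (Fibre (suc t) (D ∸ suc t) ⊎ Σ (A × B) (Bounded D t))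
    Bounded-suc-↔ D t t<D = mk↔ₛ′ to from to∘from from∘to
      where
      to : Σ (A × B) (Bounded D (suc t)) → Fibre (suc t) (D ∸ suc t) ⊎ Σ (A × B) (Bounded D t)
      to ((a , b) , (e , a≤)) with wa a ℕ.≟ suc t
      ... | yes p = inj₁ ((a , p) , (b , trans (sym (ℕₚ.m+n∸m≡n (wa a) (wb b))) (cong₂ _∸_ e p)))
      ... | no ¬p = inj₂ ((a , b) , (e , ℕₚ.≤-pred (ℕₚ.≤∧≢⇒< a≤ ¬p)))
      from : Fibre (suc t) (D ∸ suc t) ⊎ Σ (A × B) (Bounded D t) → Σ (A × B) (Bounded D (suc t))
      from (inj₁ ((a , p) , (b , q))) = (a , b) , (trans (cong₂ ℕ._+_ p q) (ℕₚ.m+[n∸m]≡n t<D) , ℕₚ.≤-reflexive p)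
      from (inj₂ ((a , b) , (e , a≤))) = (a , b) , (e , ℕₚ.m≤n⇒m≤1+n a≤)
      to∘from : ∀ y → to (from y) ≡ y
      to∘from (inj₁ ((a , p) , (b , q))) with wa a ℕ.≟ suc t
      ... | yes p′ = cong₂ (λ u v → inj₁ ((a , u) , (b , v))) (uip p′ p) (uip _ q)
      ... | no ¬p = ⊥-elim (¬p p)
      to∘from (inj₂ ((a , b) , (e , a≤))) with wa a ℕ.≟ suc t
      ... | yes p′ = ⊥-elim (ℕₚ.1+n≰n (subst (ℕ._≤ t) p′ a≤))
      ... | no _ = cong inj₂ (Σ-≡-irrelevant (Bounded-irrelevant D t) refl)
      from∘to : ∀ x → from (to x) ≡ x
      from∘to ((a , b) , (e , a≤)) with wa a ℕ.≟ suc t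
      ... | yes _ = Σ-≡-irrelevant (Bounded-irrelevant D (suc t)) refl
      ... | no _ = Σ-≡-irrelevant (Bounded-irrelevant D (suc t)) refl

    convAux-counts : ∀ D t → t ℕ.≤ D → Σ (A × B) (Bounded D t) ↔ Fin (convAux f g D t)
    convAux-counts D zero _ = ↔-trans (Bounded-zero-↔ D) (Fibre-↔ 0 D)
    convAux-counts D (suc t) t<D = ↔-trans (Bounded-suc-↔ D t t<D)
      (↔-trans (Fibre-↔ (suc t) (D ∸ suc t) ⊎-↔ convAux-counts D t (ℕₚ.<⇒≤ t<D)) (↔-sym Finₚ.+↔⊎))

  ⊛-counts : CountedBy (λ ((a , b) : A × B) → wa a ℕ.+ wb b) (f ⊛ g)
  ⊛-counts D = ↔-trans
    (Σ-↔-irrelevant uip (Bounded-irrelevant D D) (λ x _ → x) (λ x _ → x)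
      (λ (a , b) e → e , subst (wa a ℕ.≤_) e (ℕₚ.m≤m+n (wa a) (wb b))) (λ _ → proj₁)
      (λ _ _ → refl) (λ _ _ → refl))
    (convAux-counts D D ℕₚ.≤-refl)

vecWeight : {A : Set} → (A → ℕ) → ∀ {m} → Vec A m → ℕ
vecWeight w v = Vec.sum (Vec.map w v)

^ˢ-counts : {A : Set} {w : A → ℕ} {f : Series} → CountedBy w f →
            ∀ m → CountedBy (vecWeight w {m}) (f ^ˢ m)
^ˢ-counts count zero zero    = mk↔ₛ′ (λ _ → zero) (λ _ → [] , refl) (λ { zero → refl }) (λ { ([] , refl) → refl })
^ˢ-counts count zero (suc D) = mk↔ₛ′ (λ { ([] , ()) }) (λ ()) (λ ()) (λ { ([] , ()) })
^ˢ-counts {w = w} count (suc m) D = ↔-trans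
  (Σ-↔-irrelevant {P = λ v → vecWeight w v ≡ D} {Q = λ (a , v) → w a ℕ.+ vecWeight w v ≡ D}
    uip uip (λ { (a ∷ v) _ → a , v }) (λ (a , v) _ → a ∷ v)
    (λ { (a ∷ v) e → e }) (λ _ e → e) (λ { (a ∷ v) _ → refl }) (λ _ _ → refl))
  (⊛-counts count (^ˢ-counts count m) D)

-- The cycle lemma

prefixSum : (ℕ → ℤ) → ℕ → ℤ
prefixSum f zero    = 0ℤ
prefixSum f (suc t) = prefixSum f t ℤ.+ f t

prefixSum-cong : ∀ {f g : ℕ → ℤ} t → (∀ i → i ℕ.< t → f i ≡ g i) → prefixSum f t ≡ prefixSum g t
prefixSum-cong zero    f≗g = refl
prefixSum-cong (suc t) f≗g =
  cong₂ ℤ._+_ (prefixSum-cong t (λ i i<t → f≗g i (ℕₚ.m<n⇒m<1+n i<t))) (f≗g t ℕₚ.≤-refl)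

prefixSum-+ : ∀ f a t → prefixSum f (a ℕ.+ t) ≡ prefixSum f a ℤ.+ prefixSum (λ i → f (a ℕ.+ i)) t
prefixSum-+ f a zero = trans (cong (prefixSum f) (ℕₚ.+-identityʳ a)) (sym (ℤₚ.+-identityʳ _))
prefixSum-+ f a (suc t) = begin
  prefixSum f (a ℕ.+ suc t)                                          ≡⟨ cong (prefixSum f) (ℕₚ.+-suc a t) ⟩
  prefixSum f (a ℕ.+ t) ℤ.+ f (a ℕ.+ t)                               ≡⟨ cong (ℤ._+ f (a ℕ.+ t)) (prefixSum-+ f a t) ⟩
  (prefixSum f a ℤ.+ prefixSum f′ t) ℤ.+ f (a ℕ.+ t)                  ≡⟨ ℤₚ.+-assoc (prefixSum f a) _ _ ⟩
  prefixSum f a ℤ.+ (prefixSum f′ t ℤ.+ f (a ℕ.+ t))                  ∎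
  where
  open ≡-Reasoning
  f′ : ℕ → ℤ
  f′ i = f (a ℕ.+ i)

heightSum : {A : Set} → (A → ℤ) → List A → ℤ
heightSum h []       = 0ℤ
heightSum h (x ∷ xs) = h x ℤ.+ heightSum h xs

prefixSum-take : {A : Set} (h : A → ℤ) {m : ℕ} (v : Vec A m) (f : ℕ → ℤ) →
  (∀ i (i<m : i ℕ.< m) → f i ≡ h (Vec.lookup v (fromℕ< i<m))) →
  ∀ t → t ℕ.≤ m → prefixSum f t ≡ heightSum h (List.take t (Vec.toList v))
prefixSum-take h v       f f≡h zero    _         = refl
prefixSum-take h (x ∷ v) f f≡h (suc t) (s≤s t≤m) = begin
  prefixSum f (1 ℕ.+ t)                               ≡⟨ prefixSum-+ f 1 t ⟩
  (0ℤ ℤ.+ f 0) ℤ.+ prefixSum (f ∘ suc) t              ≡⟨ cong₂ ℤ._+_ (trans (ℤₚ.+-identityˡ (f 0)) (f≡h 0 (s≤s z≤n)))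
                                                          (prefixSum-take h v (f ∘ suc) (λ i i<m → f≡h (suc i) (s≤s i<m)) t t≤m) ⟩
  h x ℤ.+ heightSum h (List.take t (Vec.toList v))    ∎
  where open ≡-Reasoning

mod-cong : ∀ m k n .{{_ : ℕ.NonZero n}} → m % n ≡ k % n → m mod n ≡ k mod n
mod-cong m k n eq = Finₚ.fromℕ<-cong _ _ eq (m%n<n m n) (m%n<n k n)

%-toℕ-mod-+ : ∀ m k n .{{_ : ℕ.NonZero n}} → (toℕ (m mod n) ℕ.+ k) % n ≡ (m ℕ.+ k) % n
%-toℕ-mod-+ m k n = begin
  (toℕ (m mod n) ℕ.+ k) % n       ≡⟨ cong (λ x → (x ℕ.+ k) % n) (Finₚ.toℕ-fromℕ< (m%n<n m n)) ⟩
  (m % n ℕ.+ k) % n               ≡⟨ %-distribˡ-+ (m % n) k n ⟩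
  (m % n % n ℕ.+ k % n) % n       ≡⟨ cong (λ x → (x ℕ.+ k % n) % n) (m%n%n≡m%n m n) ⟩
  (m % n ℕ.+ k % n) % n           ≡⟨ %-distribˡ-+ m k n ⟨
  (m ℕ.+ k) % n                   ∎
  where open ≡-Reasoning

mod-toℕ-mod-+ : ∀ m k n .{{_ : ℕ.NonZero n}} → (toℕ (m mod n) ℕ.+ k) mod n ≡ (m ℕ.+ k) mod n
mod-toℕ-mod-+ m k n = mod-cong (toℕ (m mod n) ℕ.+ k) (m ℕ.+ k) n (%-toℕ-mod-+ m k n)

toℕ-mod : ∀ {n} .{{_ : ℕ.NonZero n}} (i : Fin n) → toℕ i mod n ≡ i
toℕ-mod {n} i = trans (Finₚ.fromℕ<-cong _ _ (m<n⇒m%n≡m (Finₚ.toℕ<n i)) _ (Finₚ.toℕ<n i))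
                      (Finₚ.fromℕ<-toℕ i (Finₚ.toℕ<n i))

undo-shift : ∀ {n} .{{_ : ℕ.NonZero n}} s (r : Fin n) → s ℕ.≤ n → (s ℕ.+ toℕ r) % n ≡ 0 → (n ∸ s) mod n ≡ r
undo-shift {n} s r s≤n s+r≡0 = trans (mod-cong (n ∸ s) (toℕ r) n (begin
  (n ∸ s) % n                                ≡⟨ m%n%n≡m%n (n ∸ s) n ⟨
  (n ∸ s) % n % n                            ≡⟨ cong (_% n) (ℕₚ.+-identityʳ ((n ∸ s) % n)) ⟨
  ((n ∸ s) % n ℕ.+ 0) % n                    ≡⟨ cong (λ x → ((n ∸ s) % n ℕ.+ x) % n) s+r≡0 ⟨
  ((n ∸ s) % n ℕ.+ (s ℕ.+ toℕ r) % n) % n    ≡⟨ %-distribˡ-+ (n ∸ s) (s ℕ.+ toℕ r) n ⟨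
  ((n ∸ s) ℕ.+ (s ℕ.+ toℕ r)) % n            ≡⟨ cong (_% n) (ℕₚ.+-assoc (n ∸ s) s (toℕ r)) ⟨
  ((n ∸ s) ℕ.+ s ℕ.+ toℕ r) % n              ≡⟨ cong (λ x → (x ℕ.+ toℕ r) % n) (ℕₚ.m∸n+n≡m s≤n) ⟩
  (n ℕ.+ toℕ r) % n                          ≡⟨ cong (_% n) (ℕₚ.+-comm n (toℕ r)) ⟩
  (toℕ r ℕ.+ n) % n                          ≡⟨ [m+n]%n≡m%n (toℕ r) n ⟩
  toℕ r % n                                  ∎))
  (toℕ-mod r)
  where open ≡-Reasoning

module CycleLemma {L : Set} (h : L → ℤ) (n-1 : ℕ) where

  n : ℕ
  n = suc n-1

  height : Vec L n → ℕ → ℤ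
  height w t = h (Vec.lookup w (t mod n))

  level : Vec L n → ℕ → ℤ
  level w = prefixSum (height w)

  rotate : ℕ → Vec L n → Vec L n
  rotate r w = Vec.tabulate (λ i → Vec.lookup w ((toℕ i ℕ.+ r) mod n))

  lookup-rotate : ∀ r w i → Vec.lookup (rotate r w) i ≡ Vec.lookup w ((toℕ i ℕ.+ r) mod n)
  lookup-rotate r w = Vecₚ.lookup∘tabulate (λ i → Vec.lookup w ((toℕ i ℕ.+ r) mod n))

  height-rotate : ∀ r w t → height (rotate r w) t ≡ height w (t ℕ.+ r)
  height-rotate r w t = cong h (trans (lookup-rotate r w (t mod n)) (cong (Vec.lookup w) (mod-toℕ-mod-+ t r n)))

  rotate-cong : ∀ {r r′} w → r % n ≡ r′ % n → rotate r w ≡ rotate r′ w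
  rotate-cong {r} {r′} w eq = Vecₚ.tabulate-cong λ i → cong (Vec.lookup w) (mod-cong (toℕ i ℕ.+ r) (toℕ i ℕ.+ r′) n (begin
    (toℕ i ℕ.+ r) % n               ≡⟨ %-distribˡ-+ (toℕ i) r n ⟩
    (toℕ i % n ℕ.+ r % n) % n       ≡⟨ cong (λ x → (toℕ i % n ℕ.+ x) % n) eq ⟩
    (toℕ i % n ℕ.+ r′ % n) % n      ≡⟨ %-distribˡ-+ (toℕ i) r′ n ⟨
    (toℕ i ℕ.+ r′) % n              ∎))
    where open ≡-Reasoning

  rotate-zero : ∀ w → rotate 0 w ≡ w
  rotate-zero w = trans (Vecₚ.tabulate-cong λ i → cong (Vec.lookup w)
                           (trans (cong (_mod n) (ℕₚ.+-identityʳ (toℕ i))) (toℕ-mod i)))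
                        (Vecₚ.tabulate∘lookup w)

  rotate-rotate : ∀ a b w → rotate a (rotate b w) ≡ rotate (a ℕ.+ b) w
  rotate-rotate a b w = Vecₚ.tabulate-cong λ i → begin
    Vec.lookup (rotate b w) ((toℕ i ℕ.+ a) mod n)                    ≡⟨ lookup-rotate b w ((toℕ i ℕ.+ a) mod n) ⟩
    Vec.lookup w ((toℕ ((toℕ i ℕ.+ a) mod n) ℕ.+ b) mod n)          ≡⟨ cong (Vec.lookup w) (mod-toℕ-mod-+ (toℕ i ℕ.+ a) b n) ⟩
    Vec.lookup w ((toℕ i ℕ.+ a ℕ.+ b) mod n)                         ≡⟨ cong (λ x → Vec.lookup w (x mod n)) (ℕₚ.+-assoc (toℕ i) a b) ⟩
    Vec.lookup w ((toℕ i ℕ.+ (a ℕ.+ b)) mod n)                       ∎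
    where open ≡-Reasoning

  rotate-undo : ∀ s w → s ℕ.≤ n → rotate (toℕ ((n ∸ s) mod n)) (rotate s w) ≡ w
  rotate-undo s w s≤n = begin
    rotate (toℕ ((n ∸ s) mod n)) (rotate s w)   ≡⟨ rotate-rotate _ s w ⟩
    rotate (toℕ ((n ∸ s) mod n) ℕ.+ s) w        ≡⟨ rotate-cong w (%-toℕ-mod-+ (n ∸ s) s n) ⟩
    rotate ((n ∸ s) ℕ.+ s) w                    ≡⟨ rotate-cong w (cong (_% n) (ℕₚ.m∸n+n≡m s≤n)) ⟩
    rotate n w                                  ≡⟨ rotate-cong w (n%n≡0 n) ⟩
    rotate 0 w                                  ≡⟨ rotate-zero w ⟩
    w                                           ∎
    where open ≡-Reasoning

  level-rotate : ∀ r w m → level (rotate r w) m ≡ level w (r ℕ.+ m) - level w r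
  level-rotate r w m = begin
    prefixSum (height (rotate r w)) m                     ≡⟨ prefixSum-cong m (λ i _ → trans (height-rotate r w i) (cong (height w) (ℕₚ.+-comm i r))) ⟩
    prefixSum (λ i → height w (r ℕ.+ i)) m                ≡⟨ cancel (level w r) _ ⟨
    (level w r ℤ.+ prefixSum (λ i → height w (r ℕ.+ i)) m) - level w r ≡⟨ cong (_- level w r) (prefixSum-+ (height w) r m) ⟨
    level w (r ℕ.+ m) - level w r                         ∎
    where
    open ≡-Reasoning
    cancel : ∀ x y → (x ℤ.+ y) - x ≡ y
    cancel = solve-∀

  height-periodic : ∀ w i → height w (n ℕ.+ i) ≡ height w i
  height-periodic w i = cong (h ∘ Vec.lookup w)
    (mod-cong (n ℕ.+ i) i n (trans (cong (_% n) (ℕₚ.+-comm n i)) ([m+n]%n≡m%n i n)))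

  level-periodic : ∀ w t → level w (t ℕ.+ n) ≡ level w n ℤ.+ level w t
  level-periodic w t = trans (cong (level w) (ℕₚ.+-comm t n))
    (trans (prefixSum-+ (height w) n t) (cong (λ x → level w n ℤ.+ x) (prefixSum-cong t (λ i _ → height-periodic w i))))

  level-rotate-n : ∀ r w → level (rotate r w) n ≡ level w n
  level-rotate-n r w = trans (level-rotate r w n)
    (trans (cong (_- level w r) (level-periodic w r)) (cancel (level w n) (level w r)))
    where
    cancel : ∀ x y → (x ℤ.+ y) - y ≡ x
    cancel = solve-∀

  level-take : ∀ w t → t ℕ.≤ n → level w t ≡ heightSum h (List.take t (Vec.toList w))
  level-take w = prefixSum-take h w (height w)
    (λ i i<n → cong (h ∘ Vec.lookup w) (Finₚ.fromℕ<-cong _ _ (m<n⇒m%n≡m i<n) (m%n<n i n) i<n))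

  level-n : ∀ w → level w n ≡ heightSum h (Vec.toList w)
  level-n w = trans (level-take w n ℕₚ.≤-refl)
    (cong (heightSum h) (Listₚ.take-all n (Vec.toList w) (ℕₚ.≤-reflexive (Vecₚ.length-toList w))))

  IsGood : Vec L n → Set
  IsGood w = level w n ≡ ℤ.-1ℤ × (∀ {k} → k ℕ.< n-1 → 0ℤ ℤ.≤ level w (suc k))

  good? : ∀ w → Dec (IsGood w)
  good? w = (level w n ℤₚ.≟ ℤ.-1ℤ) ×-dec ℕₚ.allUpTo? (λ k → 0ℤ ℤₚ.≤? level w (suc k)) n-1

  IsGood-level : ∀ w → IsGood w → ∀ {k} → 0 ℕ.< k → k ℕ.< n → 0ℤ ℤ.≤ level w k
  IsGood-level w (_ , positive) {suc k} _ (s≤s k<n-1) = positive k<n-1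

  Good : Set
  Good = Σ (Vec L n) (λ w → True (good? w))

  Balanced : Set
  Balanced = Σ (Vec L n) (λ w → level w n ≡ ℤ.-1ℤ)

  firstArgMin : Vec L n → ℕ → ℕ
  firstArgMin w zero = 0
  firstArgMin w (suc k) with level w (suc k) ℤₚ.<? level w (firstArgMin w k)
  ... | yes _ = suc k
  ... | no _  = firstArgMin w k

  firstArgMin-≤ : ∀ w k → firstArgMin w k ℕ.≤ k
  firstArgMin-≤ w zero = z≤n
  firstArgMin-≤ w (suc k) with level w (suc k) ℤₚ.<? level w (firstArgMin w k)
  ... | yes _ = ℕₚ.≤-refl
  ... | no _  = ℕₚ.m≤n⇒m≤1+n (firstArgMin-≤ w k)

  firstArgMin-minimal : ∀ w k u → u ℕ.≤ k → level w (firstArgMin w k) ℤ.≤ level w u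
  firstArgMin-minimal w zero .zero z≤n = ℤₚ.≤-refl
  firstArgMin-minimal w (suc k) u u≤ with level w (suc k) ℤₚ.<? level w (firstArgMin w k) | u ℕ.≟ suc k
  ... | yes _   | yes refl = ℤₚ.≤-refl
  ... | yes lt  | no u≢    = ℤₚ.≤-trans (ℤₚ.<⇒≤ lt) (firstArgMin-minimal w k u (ℕₚ.≤-pred (ℕₚ.≤∧≢⇒< u≤ u≢)))
  ... | no ¬lt  | yes refl = ℤₚ.≮⇒≥ ¬lt
  ... | no _    | no u≢    = firstArgMin-minimal w k u (ℕₚ.≤-pred (ℕₚ.≤∧≢⇒< u≤ u≢))

  firstArgMin-first : ∀ w k u → u ℕ.< firstArgMin w k → level w (firstArgMin w k) ℤ.< level w u
  firstArgMin-first w (suc k) u u< with level w (suc k) ℤₚ.<? level w (firstArgMin w k)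
  ... | yes lt = ℤₚ.<-≤-trans lt (firstArgMin-minimal w k u (ℕₚ.≤-pred u<))
  ... | no _   = firstArgMin-first w k u u<

  -- Start w just after its first lowest point s: levels up to n are ≥ level w s, and a level u + n
  -- past the turn is level w u - 1 with u < s, where level w u > level w s strictly.
  rotate-firstArgMin-good : ∀ w → level w n ≡ ℤ.-1ℤ → IsGood (rotate (firstArgMin w n-1) w)
  rotate-firstArgMin-good w total = trans (level-rotate-n s w) total , λ {k} k<n-1 →
    subst (0ℤ ℤ.≤_) (sym (level-rotate s w (suc k))) (rise (suc k) (s≤s k<n-1))
    where
    s : ℕ
    s = firstArgMin w n-1

    rise : ∀ m → m ℕ.< n → 0ℤ ℤ.≤ level w (s ℕ.+ m) - level w s
    rise m m<n with s ℕ.+ m ℕ.<? n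
    ... | yes s+m<n = ℤₚ.i≤j⇒0≤j-i (firstArgMin-minimal w n-1 (s ℕ.+ m) (ℕₚ.≤-pred s+m<n))
    ... | no s+m≮n = subst (0ℤ ℤ.≤_) (cong (_- level w s) (sym wrap)) (after-drop (firstArgMin-first w n-1 u u<s))
      where
      u : ℕ
      u = s ℕ.+ m ∸ n
      u+n≡s+m : u ℕ.+ n ≡ s ℕ.+ m
      u+n≡s+m = ℕₚ.m∸n+n≡m (ℕₚ.≮⇒≥ s+m≮n)
      u<s : u ℕ.< s
      u<s = ℕₚ.+-cancelʳ-< n u s (subst (ℕ._< s ℕ.+ n) (sym u+n≡s+m) (ℕₚ.+-monoʳ-< s m<n))
      wrap : level w (s ℕ.+ m) ≡ ℤ.-1ℤ ℤ.+ level w u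
      wrap = trans (cong (level w) (sym u+n≡s+m)) (trans (level-periodic w u) (cong (ℤ._+ level w u) total))
      after-drop : ∀ {a b} → a ℤ.< b → 0ℤ ℤ.≤ (ℤ.-1ℤ ℤ.+ b) - a
      after-drop {a} {b} a<b = subst (0ℤ ℤ.≤_) (shift b a) (ℤₚ.i≤j⇒0≤j-i (ℤₚ.i<j⇒suc[i]≤j a<b))
        where
        shift : ∀ b a → b - (1ℤ ℤ.+ a) ≡ (ℤ.-1ℤ ℤ.+ b) - a
        shift = solve-∀

  -- If w and its rotation by 0 < t < n were both good, level w t ≥ 0 and the rotation's level
  -- at n - t, which is -1 - level w t, would both be non-negative.
  good-rotation-unique : ∀ w t → IsGood w → IsGood (rotate t w) → t ℕ.< n → t ≡ 0
  good-rotation-unique w zero    _    _       _   = refl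
  good-rotation-unique w (suc t′) good-w good-rw t<n = ⊥-elim (ℤₚ.<⇒≱ (ℤ.-<+ {0} {0}) (subst (0ℤ ℤ.≤_) (cancel (level w t)) sum≥0))
    where
    t : ℕ
    t = suc t′
    k : ℕ
    k = n ∸ t
    t+k≡n : t ℕ.+ k ≡ n
    t+k≡n = ℕₚ.m+[n∸m]≡n (ℕₚ.<⇒≤ t<n)
    level-t≥0 : 0ℤ ℤ.≤ level w t
    level-t≥0 = IsGood-level w good-w (s≤s z≤n) t<n
    level-k≥0 : 0ℤ ℤ.≤ ℤ.-1ℤ - level w t
    level-k≥0 = subst (0ℤ ℤ.≤_)
      (trans (level-rotate t w k) (cong (_- level w t) (trans (cong (level w) t+k≡n) (proj₁ good-w))))
      (IsGood-level (rotate t w) good-rw (ℕₚ.m<n⇒0<n∸m t<n) (ℕₚ.∸-monoʳ-< {o = 0} (s≤s z≤n) (ℕₚ.<⇒≤ t<n)))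
    sum≥0 : 0ℤ ℤ.≤ level w t ℤ.+ (ℤ.-1ℤ - level w t)
    sum≥0 = ℤₚ.+-mono-≤ level-t≥0 level-k≥0
    cancel : ∀ a → a ℤ.+ (ℤ.-1ℤ - a) ≡ ℤ.-1ℤ
    cancel = solve-∀

  cycle-lemma : (Good × Fin n) ↔ Balanced
  cycle-lemma = mk↔ₛ′ to from to∘from from∘to
    where
    s≤n : ∀ w → firstArgMin w n-1 ℕ.≤ n
    s≤n w = ℕₚ.m≤n⇒m≤1+n (firstArgMin-≤ w n-1)

    to : Good × Fin n → Balanced
    to ((g , good-g) , r) = rotate (toℕ r) g , trans (level-rotate-n (toℕ r) g) (proj₁ (toWitness {a? = good? g} good-g))

    from : Balanced → Good × Fin n
    from (w , total) = (rotate (firstArgMin w n-1) w , fromWitness (rotate-firstArgMin-good w total))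
                     , (n ∸ firstArgMin w n-1) mod n

    to∘from : ∀ y → to (from y) ≡ y
    to∘from (w , _) = Σ-≡-irrelevant uip (rotate-undo (firstArgMin w n-1) w (s≤n w))

    from∘to : ∀ x → from (to x) ≡ x
    from∘to x@((g , good-g) , r) = cong₂ _,_ (Σ-≡-irrelevant T-irrelevant g′≡g) (undo-shift s r (s≤n w) t≡0)
      where
      w : Vec L n
      w = proj₁ (to x)
      s : ℕ
      s = firstArgMin w n-1
      t : ℕ
      t = (s ℕ.+ toℕ r) % n
      g′≡rotate-t : rotate s w ≡ rotate t g
      g′≡rotate-t = trans (rotate-rotate s (toℕ r) g) (rotate-cong g (sym (m%n%n≡m%n (s ℕ.+ toℕ r) n)))
      t≡0 : t ≡ 0
      t≡0 = good-rotation-unique g t (toWitness {a? = good? g} good-g)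
              (subst IsGood g′≡rotate-t (rotate-firstArgMin-good w (proj₂ (to x)))) (m%n<n (s ℕ.+ toℕ r) n)
      g′≡g : rotate s w ≡ g
      g′≡g = trans g′≡rotate-t (trans (cong (λ m → rotate m g) t≡0) (rotate-zero g))

-- Paths as words in the letters S_k V^j

walkEnd-++ : ∀ p (a b : List Step) → walkEnd p (a ++ b) ≡ walkEnd (walkEnd p a) b
walkEnd-++ p []      b = refl
walkEnd-++ p (s ∷ a) b = walkEnd-++ (move p s) a b

AboveExceptLast-++ : ∀ p (a b : List Step) → AboveExceptLast p a → AboveExceptLast (walkEnd p a) b →
                     AboveExceptLast p (a ++ b)
AboveExceptLast-++ p []      b _          above-b = above-b
AboveExceptLast-++ p (s ∷ a) b (y≥0 , above-a) above-b = y≥0 , AboveExceptLast-++ (move p s) a b above-a above-b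

AboveExceptLast-++⁻ʳ : ∀ p (a b : List Step) → AboveExceptLast p (a ++ b) → AboveExceptLast (walkEnd p a) b
AboveExceptLast-++⁻ʳ p []      b above = above
AboveExceptLast-++⁻ʳ p (s ∷ a) b (_ , above) = AboveExceptLast-++⁻ʳ (move p s) a b above

descent : ℕ → List Step
descent j = List.replicate j V

walkEnd-descent : ∀ x y j → walkEnd (x , y) (descent j) ≡ (x , y - + j)
walkEnd-descent x y zero    = cong (x ,_) (sym (ℤₚ.+-identityʳ y))
walkEnd-descent x y (suc j) = trans (walkEnd-descent x (y - 1ℤ) j) (cong (x ,_) (regroup y (+ j)))
  where
  regroup : ∀ a b → (a - 1ℤ) - b ≡ a - (1ℤ ℤ.+ b)
  regroup = solve-∀

AboveExceptLast-descent : ∀ x y j → ℤ.-1ℤ ℤ.≤ y - + j → AboveExceptLast (x , y) (descent j)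
AboveExceptLast-descent x y zero    _ = tt
AboveExceptLast-descent x y (suc j) bottom≥-1 =
  y≥0 , AboveExceptLast-descent x (y - 1ℤ) j (subst (ℤ.-1ℤ ℤ.≤_) (regroup y (+ j)) bottom≥-1)
  where
  regroup : ∀ a b → a - (1ℤ ℤ.+ b) ≡ (a - 1ℤ) - b
  regroup = solve-∀
  as-pred : ∀ a b → a - (1ℤ ℤ.+ b) ≡ ℤ.-1ℤ ℤ.+ (a - b)
  as-pred = solve-∀
  y≥0 : 0ℤ ℤ.≤ y
  y≥0 = ℤₚ.≤-trans (ℤₚ.i<j⇒suc[i]≤j (ℤₚ.i≤pred[j]⇒i<j (subst (ℤ.-1ℤ ℤ.≤_) (as-pred y (+ j)) bottom≥-1)))
                   (ℤₚ.i-j≤i y (+ j))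

module Letters (inN : ℤ → Bool) where

  Allowed : Set
  Allowed = Σ ℤ (λ k → inN k ≡ true)

  -- (j , k) stands for the block S_k V^j
  Letter : Set
  Letter = ℕ × Allowed

  letterHeight : Letter → ℤ
  letterHeight (j , (k , _)) = k - + j

  expand : List Letter → List Step
  expand []                  = []
  expand ((j , (k , _)) ∷ ls) = S k ∷ (descent j ++ expand ls)

  All-expand : ∀ ls → All (InWithV inN) (expand ls)
  All-expand []                  = []
  All-expand ((j , (k , k∈N)) ∷ ls) = k∈N ∷ Allₚ.++⁺ (Allₚ.replicate⁺ j tt) (All-expand ls)

  walkEnd-letter : ∀ x y l → walkEnd (x , y) (S (proj₁ (proj₂ l)) ∷ descent (proj₁ l)) ≡ (x ℤ.+ 1ℤ , y ℤ.+ letterHeight l)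
  walkEnd-letter x y (j , (k , _)) = trans (walkEnd-descent (x ℤ.+ 1ℤ) (y ℤ.+ k) j) (cong (x ℤ.+ 1ℤ ,_) (ℤₚ.+-assoc y k (ℤ.- + j)))

  walkEnd-expand : ∀ x y ls → walkEnd (x , y) (expand ls) ≡ (x ℤ.+ + length ls , y ℤ.+ heightSum letterHeight ls)
  walkEnd-expand x y [] = cong₂ _,_ (sym (ℤₚ.+-identityʳ x)) (sym (ℤₚ.+-identityʳ y))
  walkEnd-expand x y (l@(j , (k , _)) ∷ ls) = begin
    walkEnd (move (x , y) (S k)) (descent j ++ expand ls)                ≡⟨ walkEnd-++ _ (descent j) (expand ls) ⟩
    walkEnd (walkEnd (x , y) (S k ∷ descent j)) (expand ls)               ≡⟨ cong (λ p → walkEnd p (expand ls)) (walkEnd-letter x y l) ⟩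
    walkEnd (x ℤ.+ 1ℤ , y ℤ.+ letterHeight l) (expand ls)                ≡⟨ walkEnd-expand _ _ ls ⟩
    ((x ℤ.+ 1ℤ) ℤ.+ + length ls , (y ℤ.+ letterHeight l) ℤ.+ heightSum letterHeight ls)
                                                                         ≡⟨ cong₂ _,_ (ℤₚ.+-assoc x 1ℤ _) (ℤₚ.+-assoc y _ _) ⟩
    (x ℤ.+ (1ℤ ℤ.+ + length ls) , y ℤ.+ (letterHeight l ℤ.+ heightSum letterHeight ls)) ∎
    where open ≡-Reasoning

  StartsAbove : ℤ → List Letter → Set
  StartsAbove y []       = ⊤
  StartsAbove y (l ∷ ls) = 0ℤ ℤ.≤ y × StartsAbove (y ℤ.+ letterHeight l) ls

  AboveExceptLast⇒StartsAbove : ∀ x y ls → AboveExceptLast (x , y) (expand ls) → StartsAbove y ls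
  AboveExceptLast⇒StartsAbove x y []                       _                 = tt
  AboveExceptLast⇒StartsAbove x y (l@(j , (k , _)) ∷ ls) (y≥0 , above) = y≥0 ,
    AboveExceptLast⇒StartsAbove (x ℤ.+ 1ℤ) (y ℤ.+ letterHeight l) ls
      (subst (λ p → AboveExceptLast p (expand ls)) (walkEnd-letter x y l)
        (AboveExceptLast-++⁻ʳ _ (descent j) (expand ls) above))

  StartsAbove-last : ∀ y ls → StartsAbove y ls → y ℤ.+ heightSum letterHeight ls ≡ ℤ.-1ℤ → ℤ.-1ℤ ℤ.≤ y
  StartsAbove-last y []       _         end = ℤₚ.≤-reflexive (trans (sym end) (ℤₚ.+-identityʳ y))
  StartsAbove-last y (l ∷ ls) (y≥0 , _) _   = ℤₚ.≤-trans (ℤₚ.<⇒≤ ℤ.-<+) y≥0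

  -- The final height -1 keeps the last run of V steps from going below -1.
  StartsAbove⇒AboveExceptLast : ∀ x y ls → StartsAbove y ls → y ℤ.+ heightSum letterHeight ls ≡ ℤ.-1ℤ →
                                AboveExceptLast (x , y) (expand ls)
  StartsAbove⇒AboveExceptLast x y []                       _                 _   = tt
  StartsAbove⇒AboveExceptLast x y (l@(j , (k , _)) ∷ ls) (y≥0 , starts) end = y≥0 ,
    AboveExceptLast-++ _ (descent j) (expand ls)
      (AboveExceptLast-descent _ _ j (subst (ℤ.-1ℤ ℤ.≤_) (sym (ℤₚ.+-assoc y k (ℤ.- + j))) (StartsAbove-last _ ls starts end′)))
      (subst (λ p → AboveExceptLast p (expand ls)) (sym (walkEnd-letter x y l))
        (StartsAbove⇒AboveExceptLast (x ℤ.+ 1ℤ) (y ℤ.+ letterHeight l) ls starts end′))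
    where
    end′ : (y ℤ.+ letterHeight l) ℤ.+ heightSum letterHeight ls ≡ ℤ.-1ℤ
    end′ = trans (ℤₚ.+-assoc y _ _) end

  parse : (ss : List Step) → All (InWithV inN) ss → ℕ × List Letter
  parse []       []       = 0 , []
  parse (V ∷ ss) (_ ∷ ps) = let (j , ls) = parse ss ps in suc j , ls
  parse (S k ∷ ss) (k∈N ∷ ps) = let (j , ls) = parse ss ps in 0 , (j , (k , k∈N)) ∷ ls

  expand-parse : ∀ ss ps → descent (proj₁ (parse ss ps)) ++ expand (proj₂ (parse ss ps)) ≡ ss
  expand-parse []         []       = refl
  expand-parse (V ∷ ss)   (_ ∷ ps) = cong (V ∷_) (expand-parse ss ps)
  expand-parse (S k ∷ ss) (_ ∷ ps) = cong (S k ∷_) (expand-parse ss ps)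

  parse-expand : ∀ j ls ps → parse (descent j ++ expand ls) ps ≡ (j , ls)
  parse-expand (suc j) ls (_ ∷ ps) = cong (λ (j , ls) → suc j , ls) (parse-expand j ls ps)
  parse-expand zero [] [] = refl
  parse-expand zero ((j , (k , k∈N)) ∷ ls) (k∈N′ ∷ ps)
    with parse (descent j ++ expand ls) ps | parse-expand j ls ps
  ... | .(j , ls) | refl = cong (λ p → 0 , (j , (k , p)) ∷ ls) (uip k∈N′ k∈N)

  StartsAbove⇒prefixes : ∀ y ls → StartsAbove y ls →
    ∀ t → t ℕ.< length ls → 0ℤ ℤ.≤ y ℤ.+ heightSum letterHeight (List.take t ls)
  StartsAbove⇒prefixes y (l ∷ ls) (y≥0 , _) zero _ = subst (0ℤ ℤ.≤_) (sym (ℤₚ.+-identityʳ y)) y≥0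
  StartsAbove⇒prefixes y (l ∷ ls) (_ , starts) (suc t) (s≤s t<) =
    subst (0ℤ ℤ.≤_) (ℤₚ.+-assoc y (letterHeight l) _) (StartsAbove⇒prefixes (y ℤ.+ letterHeight l) ls starts t t<)

  prefixes⇒StartsAbove : ∀ y ls → (∀ t → t ℕ.< length ls → 0ℤ ℤ.≤ y ℤ.+ heightSum letterHeight (List.take t ls)) →
                         StartsAbove y ls
  prefixes⇒StartsAbove y []       _        = tt
  prefixes⇒StartsAbove y (l ∷ ls) prefixes =
    subst (0ℤ ℤ.≤_) (ℤₚ.+-identityʳ y) (prefixes 0 (s≤s z≤n)) ,
    prefixes⇒StartsAbove (y ℤ.+ letterHeight l) ls
      (λ t t< → subst (0ℤ ℤ.≤_) (sym (ℤₚ.+-assoc y (letterHeight l) _)) (prefixes (suc t) (s≤s t<)))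

listToVec : {A : Set} {m : ℕ} (xs : List A) → length xs ≡ m → Vec A m
listToVec {m = zero}  []       _ = []
listToVec {m = suc m} (x ∷ xs) e = x ∷ listToVec xs (ℕₚ.suc-injective e)

toList-listToVec : {A : Set} {m : ℕ} (xs : List A) (e : length xs ≡ m) → Vec.toList (listToVec xs e) ≡ xs
toList-listToVec {m = zero}  []       _ = refl
toList-listToVec {m = suc m} (x ∷ xs) e = cong (x ∷_) (toList-listToVec xs (ℕₚ.suc-injective e))

listToVec-toList : {A : Set} {m : ℕ} (v : Vec A m) (e : length (Vec.toList v) ≡ m) → listToVec (Vec.toList v) e ≡ v
listToVec-toList []      _ = refl
listToVec-toList (x ∷ v) e = cong (x ∷_) (listToVec-toList v (ℕₚ.suc-injective e))

-- Counting the paths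

module PathCount (N : ℕ) (inN : ℤ → Bool) (below-N : ∀ k → inN k ≡ true → k ℤ.≤ + N) (n-1 : ℕ) where
  open Letters inN
  open CycleLemma letterHeight n-1

  IsPath : List Step → Set
  IsPath ss = All (InWithV inN) ss × (walkEnd (0ℤ , 0ℤ) ss ≡ (+ n , ℤ.-1ℤ)) × AboveExceptLast (0ℤ , 0ℤ) ss

  IsPath-irrelevant : Irrelevant IsPath
  IsPath-irrelevant {ss} (allowed , end , above) (allowed′ , end′ , above′) =
    cong₂ _,_ (All.irrelevant InWithV-irrelevant allowed allowed′) (cong₂ _,_ (uip end end′) (Above-irrelevant _ ss above above′))
    where
    InWithV-irrelevant : Irrelevant (InWithV inN)
    InWithV-irrelevant {V}   tt tt = refl
    InWithV-irrelevant {S _} p  q  = uip p q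
    Above-irrelevant : ∀ p ss → Nullary.Irrelevant (AboveExceptLast p ss)
    Above-irrelevant p []       tt      tt      = refl
    Above-irrelevant p (s ∷ ss) (a , x) (b , y) = cong₂ _,_ (ℤₚ.≤-irrelevant a b) (Above-irrelevant _ ss x y)

  -- A leading V would visit (0,-1) before the end, which is at x = n ≥ 1.
  parse-no-leading-V : ∀ ss ps → IsPath ss → proj₁ (parse ss ps) ≡ 0
  parse-no-leading-V []           []      _                   = refl
  parse-no-leading-V (S _ ∷ _)    (_ ∷ _) _                   = refl
  parse-no-leading-V (V ∷ [])     (_ ∷ _) (_ , end , _) with cong proj₁ end
  ... | ()
  parse-no-leading-V (V ∷ _ ∷ _)  (_ ∷ _) (_ , _ , (_ , (() , _)))

  IsGood⇒StartsAbove : ∀ w → IsGood w → StartsAbove 0ℤ (Vec.toList w)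
  IsGood⇒StartsAbove w (_ , positive) = prefixes⇒StartsAbove 0ℤ (Vec.toList w) λ
    { zero    _  → ℤₚ.≤-refl
    ; (suc k) k< → let k<n-1 = ℕₚ.≤-pred (subst (suc k ℕ.<_) (Vecₚ.length-toList w) k<) in
        subst (0ℤ ℤ.≤_) (trans (level-take w (suc k) (ℕₚ.m≤n⇒m≤1+n k<n-1)) (sym (ℤₚ.+-identityˡ _))) (positive k<n-1) }

  StartsAbove⇒IsGood : ∀ w → level w n ≡ ℤ.-1ℤ → StartsAbove 0ℤ (Vec.toList w) → IsGood w
  StartsAbove⇒IsGood w total starts = total , λ {k} k<n-1 →
    subst (0ℤ ℤ.≤_) (trans (ℤₚ.+-identityˡ _) (sym (level-take w (suc k) (ℕₚ.m≤n⇒m≤1+n k<n-1))))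
      (StartsAbove⇒prefixes 0ℤ (Vec.toList w) starts (suc k) (subst (suc k ℕ.<_) (sym (Vecₚ.length-toList w)) (s≤s k<n-1)))

  module FromPath (ss : List Step) (path : IsPath ss) where
    letters : List Letter
    letters = proj₂ (parse ss (proj₁ path))

    expand-letters : expand letters ≡ ss
    expand-letters = trans (cong (λ j → descent j ++ expand letters) (sym (parse-no-leading-V ss (proj₁ path) path)))
                           (expand-parse ss (proj₁ path))

    end : (0ℤ ℤ.+ + length letters , 0ℤ ℤ.+ heightSum letterHeight letters) ≡ (+ n , ℤ.-1ℤ)
    end = trans (sym (walkEnd-expand 0ℤ 0ℤ letters)) (trans (cong (walkEnd _) expand-letters) (proj₁ (proj₂ path)))

    length-letters : length letters ≡ n
    length-letters = ℤₚ.+-injective (trans (sym (ℤₚ.+-identityˡ _)) (cong proj₁ end))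

    word : Vec Letter n
    word = listToVec letters length-letters

    toList-word : Vec.toList word ≡ letters
    toList-word = toList-listToVec letters length-letters

    good : IsGood word
    good = StartsAbove⇒IsGood word
      (trans (level-n word) (trans (cong (heightSum letterHeight) toList-word) (trans (sym (ℤₚ.+-identityˡ _)) (cong proj₂ end))))
      (subst (StartsAbove 0ℤ) (sym toList-word)
        (AboveExceptLast⇒StartsAbove 0ℤ 0ℤ letters (subst (AboveExceptLast _) (sym expand-letters) (proj₂ (proj₂ path)))))

  path-of-good : ∀ w → IsGood w → IsPath (expand (Vec.toList w))
  path-of-good w good@(total , _) =
    All-expand (Vec.toList w) ,
    trans (walkEnd-expand 0ℤ 0ℤ (Vec.toList w))
      (cong₂ _,_ (trans (ℤₚ.+-identityˡ _) (cong +_ (Vecₚ.length-toList w))) (trans (ℤₚ.+-identityˡ _) total-height)) ,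
    StartsAbove⇒AboveExceptLast 0ℤ 0ℤ (Vec.toList w) (IsGood⇒StartsAbove w good) (trans (ℤₚ.+-identityˡ _) total-height)
    where
    total-height : heightSum letterHeight (Vec.toList w) ≡ ℤ.-1ℤ
    total-height = trans (sym (level-n w)) total

  Paths↔Good : Paths inN 1 n ↔ Good
  Paths↔Good = Σ-↔-irrelevant IsPath-irrelevant T-irrelevant
    (λ ss path → FromPath.word ss path) (λ w _ → expand (Vec.toList w))
    (λ ss path → fromWitness (FromPath.good ss path)) (λ w good → path-of-good w (toWitness good))
    (λ ss path → trans (cong expand (FromPath.toList-word ss path)) (FromPath.expand-letters ss path))
    (λ w good → let path = path-of-good w (toWitness good) in
       trans (listToVec-cong (cong proj₂ (parse-expand 0 (Vec.toList w) (proj₁ path))))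
             (listToVec-toList w (Vecₚ.length-toList w)))
    where
    listToVec-cong : ∀ {xs ys : List Letter} {e : length xs ≡ n} {e′ : length ys ≡ n} → xs ≡ ys → listToVec xs e ≡ listToVec ys e′
    listToVec-cong {e = e} {e′} refl = cong (listToVec _) (uip e e′)

  distance : Allowed → ℕ
  distance (k , _) = ℤ.∣ + N - k ∣

  +distance : ∀ a → + distance a ≡ + N - proj₁ a
  +distance (k , k∈N) = ℤₚ.0≤i⇒+∣i∣≡i (ℤₚ.i≤j⇒0≤j-i (below-N k k∈N))

  at-distance : ∀ a i → distance a ≡ i → proj₁ a ≡ + N - + i
  at-distance a i e = trans (sym (cancel (proj₁ a) (+ N))) (cong (+ N -_) (trans (sym (+distance a)) (cong +_ e)))
    where
    cancel : ∀ a b → b - (b - a) ≡ a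
    cancel = solve-∀

  geom-counts : CountedBy (λ j → j) geom
  geom-counts i = mk↔ₛ′ (λ _ → zero) (λ _ → i , refl) (λ { zero → refl }) (λ { (_ , refl) → refl })

  distance-counts : CountedBy distance (stepSeries N inN)
  distance-counts i with inN (+ N - + i) in k∈N
  ... | true  = mk↔ₛ′ (λ _ → zero) (λ _ → (+ N - + i , k∈N) , distance-N-i)
                       (λ { zero → refl }) (λ (a , e) → Σ-≡-irrelevant uip (Σ-≡-irrelevant uip (sym (at-distance a i e))))
    where
    distance-N-i : ℤ.∣ + N - (+ N - + i) ∣ ≡ i
    distance-N-i = cong ℤ.∣_∣ (cancel (+ N) (+ i))
      where
      cancel : ∀ a b → a - (a - b) ≡ b
      cancel = solve-∀
  ... | false = mk↔ₛ′ (λ (a , e) → ⊥-elim (excluded a e)) (λ ()) (λ ()) (λ (a , e) → ⊥-elim (excluded a e))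
    where
    excluded : ∀ a → distance a ≡ i → ⊥
    excluded (k , k∈N′) e with () ← trans (sym k∈N) (subst (λ x → inN x ≡ true) (at-distance (k , k∈N′) i e) k∈N′)

  Weighted : ℕ → Set
  Weighted D = Σ (Vec ℕ n × Vec Allowed n) (λ (js , ks) → vecWeight (λ j → j) js ℕ.+ vecWeight distance ks ≡ D)

  -- each letter (j , k) contributes j + (N - k) = N - letterHeight (j , k)
  weight-height : ∀ {m} (js : Vec ℕ m) (ks : Vec Allowed m) →
    + (vecWeight (λ j → j) js ℕ.+ vecWeight distance ks) ≡ + (N ℕ.* m) - heightSum letterHeight (Vec.toList (Vec.zip js ks))
  weight-height [] [] = cong +_ (sym (trans (ℕₚ.+-identityʳ (N ℕ.* 0)) (ℕₚ.*-zeroʳ N)))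
  weight-height {suc m} (j ∷ js) (a ∷ ks) = begin
    + ((j ℕ.+ Σj) ℕ.+ (distance a ℕ.+ Σd))                   ≡⟨ ℤₚ.pos-+ (j ℕ.+ Σj) (distance a ℕ.+ Σd) ⟩
    + (j ℕ.+ Σj) ℤ.+ + (distance a ℕ.+ Σd)                   ≡⟨ cong₂ ℤ._+_ (ℤₚ.pos-+ j Σj) (ℤₚ.pos-+ (distance a) Σd) ⟩
    (+ j ℤ.+ + Σj) ℤ.+ (+ distance a ℤ.+ + Σd)               ≡⟨ cong (λ x → (+ j ℤ.+ + Σj) ℤ.+ (x ℤ.+ + Σd)) (+distance a) ⟩
    (+ j ℤ.+ + Σj) ℤ.+ ((+ N - proj₁ a) ℤ.+ + Σd)            ≡⟨ regroup (+ j) (+ Σj) (+ N) (proj₁ a) (+ Σd) ⟩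
    (+ N ℤ.+ + j - proj₁ a) ℤ.+ (+ Σj ℤ.+ + Σd)              ≡⟨ cong (λ x → (+ N ℤ.+ + j - proj₁ a) ℤ.+ x) (trans (sym (ℤₚ.pos-+ Σj Σd)) (weight-height js ks)) ⟩
    (+ N ℤ.+ + j - proj₁ a) ℤ.+ (+ (N ℕ.* m) - Σh)          ≡⟨ regroup′ (+ N) (+ j) (proj₁ a) (+ (N ℕ.* m)) Σh ⟩
    (+ N ℤ.+ + (N ℕ.* m)) - ((proj₁ a - + j) ℤ.+ Σh)        ≡⟨ cong (_- ((proj₁ a - + j) ℤ.+ Σh)) (trans (sym (ℤₚ.pos-+ N (N ℕ.* m))) (cong +_ (sym (ℕₚ.*-suc N m)))) ⟩
    + (N ℕ.* suc m) - ((proj₁ a - + j) ℤ.+ Σh)              ∎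
    where
    open ≡-Reasoning
    Σj : ℕ
    Σj = vecWeight (λ j → j) js
    Σd : ℕ
    Σd = vecWeight distance ks
    Σh : ℤ
    Σh = heightSum letterHeight (Vec.toList (Vec.zip js ks))
    regroup : ∀ j a n k b → (j ℤ.+ a) ℤ.+ ((n - k) ℤ.+ b) ≡ (n ℤ.+ j - k) ℤ.+ (a ℤ.+ b)
    regroup = solve-∀
    regroup′ : ∀ n j k z h → (n ℤ.+ j - k) ℤ.+ (z - h) ≡ (n ℤ.+ z) - ((k - j) ℤ.+ h)
    regroup′ = solve-∀

  weight-level : ∀ js ks → + (vecWeight (λ j → j) js ℕ.+ vecWeight distance ks) ≡ + (N ℕ.* n) - level (Vec.zip js ks) n
  weight-level js ks = trans (weight-height js ks) (cong (+ (N ℕ.* n) -_) (sym (level-n (Vec.zip js ks))))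

  Balanced↔Weighted : Balanced ↔ Weighted (N ℕ.* n ℕ.+ 1)
  Balanced↔Weighted = Σ-↔-irrelevant uip uip (λ w _ → Vec.unzip w) (λ (js , ks) _ → Vec.zip js ks)
    (λ w total → ℤₚ.+-injective (trans (uncurry weight-level (Vec.unzip w))
       (trans (cong (λ x → + (N ℕ.* n) - level x n) (Vecₚ.zip∘unzip w)) (cong (+ (N ℕ.* n) -_) total))))
    (λ (js , ks) weight → trans (sym (cancel (+ (N ℕ.* n)) (level (Vec.zip js ks) n)))
       (trans (cong (+ (N ℕ.* n) -_) (trans (sym (weight-level js ks)) (cong +_ weight)))
              (trans (cong (+ (N ℕ.* n) -_) (ℤₚ.pos-+ (N ℕ.* n) 1)) (drop-one (+ (N ℕ.* n))))))
    (λ w _ → Vecₚ.zip∘unzip w) (λ (js , ks) _ → Vecₚ.unzip∘zip js ks)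
    where
    cancel : ∀ a x → a - (a - x) ≡ x
    cancel = solve-∀
    drop-one : ∀ a → a - (a ℤ.+ 1ℤ) ≡ ℤ.-1ℤ
    drop-one = solve-∀

  count : Σ ℕ λ c → (Paths inN 1 n ↔ Fin c) × (n ℕ.* c ≡ ((geom ^ˢ n) ⊛ (stepSeries N inN ^ˢ n)) (N ℕ.* n ℕ.+ 1))
  count = let (c , Good↔c , n*c≡C) = ×-Fin-cancel (↔-trans cycle-lemma (↔-trans Balanced↔Weighted
                (⊛-counts (^ˢ-counts geom-counts n) (^ˢ-counts distance-counts n) (N ℕ.* n ℕ.+ 1))))
          in c , ↔-trans Paths↔Good Good↔c , n*c≡C

mainTheorem8 : (N : ℕ) (inN : ℤ → Bool)
    → (∀ k → inN k ≡ true → k ≤ + N)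
    → inN (+ N) ≡ true
    → (n : ℕ) → n ≥ 1
    → Σ ℕ λ c → (Paths inN 1 n ↔ Fin c)
        × (n * c ≡ ((geom ^ˢ n) ⊛ (stepSeries N inN ^ˢ n)) (N * n + 1))
mainTheorem8 N inN below-N _ (suc n-1) _ = PathCount.count N inN below-N n-1
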